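{- For any real number $k\ge2$, let $K=\lfloor k\rfloor+1$. Every graph $G$ with minimum degree at least $2$ and average degree in $(k,K]$ contains a vertex with degree at least $K$ and 2-degree at least $D_2(k)$.
   Context: The 2-degree of a vertex is the sum of the degrees of its neighbours. For a positive integer $d$, a real $K$, and $\mathbf{x}=(x_1,\dots,x_d)\in\mathbb{Z}_{>0}^d$, let $a_K(\mathbf{x})=d+|\{i: x_i<K\}|$, $b_K(\mathbf{x})=1+\sum_{i: x_i<K}1/x_i$, and $\mathrm{aad}^*_K(\mathbf{x})=a_K(\mathbf{x})/b_K(\mathbf{x})$. For real $k\ge2$ with $K=\lfloor k\rfloor+1$, $D_2(k)$ is the minimum integer $z$ such that there exist an integer $d\ge K$ and a tuple $\mathbf{x}=(x_1,\dots,x_d)\in\mathbb{Z}_{\ge2}^d$ with $\sum_{i=1}^d x_i=z$ and $\mathrm{aad}^*_K(\mathbf{x})>k$. -}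

module Defs where

open import Data.Bool using (Bool; true; false; if_then_else_)
open import Data.Nat as ℕ using (ℕ; zero; suc; _≤_; _<?_)
open import Data.Fin using (Fin)
open import Data.List as List using (List; map; allFin; filter; length)
open import Data.Nat.ListAction using (sum)
open import Data.Vec as Vec using (Vec)
open import Data.Vec.Relation.Unary.All using (All)
open import Data.Integer using (+_)
open import Data.Rational as ℚ using (ℚ; 0ℚ; 1ℚ; _/_; ≢-nonZero)
open import Data.Rational.Properties using (_≟_)
open import Data.Product using (Σ; ∃; _×_)
open import Relation.Nullary using (¬_; yes; no)
open import Relation.Binary.PropositionalEquality using (_≡_)

-- Real numbers, represented by their strict upper rational cut.
-- A real k is encoded by  Above q  meaning  "k < q"  for rational q.
-- The fields say: the cut is inhabited, not all of ℚ, upward closed and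
-- has no least element; such sets are exactly the sets {q ∈ ℚ | k < q}
-- for real numbers k (k = inf of the set).

record Real : Set₁ where
  field
    Above     : ℚ → Set
    inhabited : ∃ λ q → Above q
    bounded   : ∃ λ q → ¬ Above q
    upward    : ∀ {p q} → Above p → p ℚ.≤ q → Above q
    open-cut  : ∀ {p} → Above p → ∃ λ q → q ℚ.< p × Above q

open Real public

nℚ : ℕ → ℚ
nℚ n = (+ n) / 1

AtLeast2 : Real → Set
AtLeast2 k = ¬ Above k (nℚ 2)

-- K = ⌊k⌋ + 1, i.e. K = m + 1 with m ≤ k < m + 1
IsFloorSuc : Real → ℕ → Set
IsFloorSuc k K = Σ ℕ λ m → (K ≡ suc m) × (¬ Above k (nℚ m)) × Above k (nℚ (suc m))

-- ratio a b = a / b (with the convention a / 0 = 0, never used below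
-- in a relevant way: all denominators are nonzero)
ratio : ℕ → ℕ → ℚ
ratio a zero    = 0ℚ
ratio a (suc b) = (+ a) / suc b

-- p / q for rationals (convention p / 0 = 0; in aad* the denominator is ≥ 1)
divℚ : ℚ → ℚ → ℚ
divℚ p q with q ≟ 0ℚ
... | yes _ = 0ℚ
... | no q≢0 = ℚ._÷_ p q {{≢-nonZero q≢0}}

small : ℕ → List ℕ → List ℕ
small K xs = filter (λ x → x <? K) xs

a-K : ℕ → {d : ℕ} → Vec ℕ d → ℕ
a-K K {d} x = d ℕ.+ length (small K (Vec.toList x))

b-K : ℕ → {d : ℕ} → Vec ℕ d → ℚ
b-K K x = 1ℚ ℚ.+ List.foldr ℚ._+_ 0ℚ (map (λ xi → ratio 1 xi) (small K (Vec.toList x)))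

aad* : ℕ → {d : ℕ} → Vec ℕ d → ℚ
aad* K x = divℚ (nℚ (a-K K x)) (b-K K x)

-- D₂(k): the minimum z such that some d ≥ K and x ∈ ℤ_{≥2}^d with
-- Σ x_i = z have aad*_K(x) > k.

Achievable : Real → ℕ → ℕ → Set
Achievable k K z =
  Σ ℕ λ d → (K ≤ d) × Σ (Vec ℕ d) λ x →
    All (λ xi → 2 ≤ xi) x × (Vec.sum x ≡ z) × Above k (aad* K x)

IsD2 : Real → ℕ → ℕ → Set
IsD2 k K z = Achievable k K z × (∀ z′ → Achievable k K z′ → z ≤ z′)

record Graph : Set where
  field
    n      : ℕ
    adj    : Fin n → Fin n → Bool
    sym    : ∀ u v → adj u v ≡ adj v u
    irrefl : ∀ v → adj v v ≡ false

open Graph public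

deg : (G : Graph) → Fin (n G) → ℕ
deg G v = sum (map (λ u → if adj G v u then 1 else 0) (allFin (n G)))

twoDeg : (G : Graph) → Fin (n G) → ℕ
twoDeg G v = sum (map (λ u → if adj G v u then deg G u else 0) (allFin (n G)))

avgDeg : Graph → ℚ
avgDeg G = ratio (sum (map (deg G) (allFin (n G)))) (n G)

-- Discharging. Fix a rational q with k < q < avgDeg G and give every vertex v the charge
-- deg v − q, so that the total charge is positive. A small vertex u (deg u < K, hence
-- deg u ≤ ⌊k⌋ < q) spreads its charge evenly over its neighbours, sending each of them the
-- nonpositive amount 1 − q / deg u; large vertices keep what they receive and the rest is
-- discarded, which can only increase the total. A large vertex v then holds
-- deg v − q + Σ (1 − q / deg u) over its small neighbours u, that is a_K(x) − q b_K(x) for the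
-- tuple x of degrees of its neighbours. So some large v has aad*_K(x) > q > k, whence x is
-- admissible in the definition of D₂(k) and D₂(k) ≤ Σ x, the 2-degree of v.

module Submission where

open import Defs
open import Data.Nat using (ℕ; _≤_)
open import Data.Rational as ℚ using (ℚ)
open import Data.Product using (∃; _×_)

open import Algebra.Bundles using (Ring)
open import Data.Bool using (Bool; true; false; not; if_then_else_; T)
open import Data.Empty using (⊥-elim)
open import Data.Fin using (Fin; zero; suc)
import Data.Integer as ℤ
import Data.Integer.Properties as ℤP
open import Data.List using (List; []; _∷_; foldr; map; filter; length; tabulate; allFin)
import Data.List.Properties as LP
import Data.List.Relation.Unary.All as AllL
import Data.List.Relation.Unary.All.Properties as AllLP
open import Data.Nat as ℕ using (zero; suc; NonZero)
import Data.Nat.Coprimality as Coprime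
open import Data.Nat.ListAction using () renaming (sum to sumℕ)
import Data.Nat.Properties as ℕP
open import Data.Product using (_,_)
open import Data.Rational using (mkℚ; 0ℚ; 1ℚ; _+_; _*_; _-_; -_; 1/_)
import Data.Rational.Properties as QP
open import Data.Rational.Solver using (module +-*-Solver)
open import Data.Vec as Vec using (Vec)
import Data.Vec.Properties as VP
import Data.Vec.Relation.Unary.All.Properties as AllV
open import Function using (_∘_; id)
open import Level using (0ℓ)
open import Relation.Binary.PropositionalEquality as ≡
  using (_≡_; refl; trans; cong; cong₂; subst; subst₂)
open import Relation.Nullary using (¬_; yes; no; does)
open import Relation.Nullary.Decidable using (T?; dec-true)
open import Relation.Unary using (Pred; Decidable)

open +-*-Solver using (solve; _:+_; _:-_; _:*_; _:=_; con)
open import Algebra.Properties.CommutativeMonoid.Sum QP.+-0-commutativeMonoid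
  using (sum; sum-syntax; sum-cong-≗; sum-replicate-zero; ∑-distrib-+; ∑-comm)
open import Algebra.Properties.Semiring.Sum (Ring.semiring QP.+-*-ring) using (*-distribˡ-sum)

nℚ≡mkℚ : ∀ n → nℚ n ≡ mkℚ (ℤ.+ n) 0 (Coprime.sym (Coprime.1-coprimeTo n))
nℚ≡mkℚ n = QP.normalize-coprime (Coprime.sym (Coprime.1-coprimeTo n))

nℚ-+ : ∀ m n → nℚ (m ℕ.+ n) ≡ nℚ m + nℚ n
nℚ-+ m n rewrite nℚ≡mkℚ m | nℚ≡mkℚ n =
  QP./-cong (≡.sym (cong₂ ℤ._+_ (ℤP.*-identityʳ (ℤ.+ m)) (ℤP.*-identityʳ (ℤ.+ n)))) refl

nℚ-mono-≤ : ∀ {m n} → m ≤ n → nℚ m ℚ.≤ nℚ n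
nℚ-mono-≤ {m} {n} m≤n rewrite nℚ≡mkℚ m | nℚ≡mkℚ n =
  ℚ.*≤* (subst₂ ℤ._≤_ (≡.sym (ℤP.*-identityʳ (ℤ.+ m))) (≡.sym (ℤP.*-identityʳ (ℤ.+ n))) (ℤ.+≤+ m≤n))

ratio≡nℚ*ratio1 : ∀ s n → ratio s n ≡ nℚ s * ratio 1 n
ratio≡nℚ*ratio1 s zero = ≡.sym (QP.*-zeroʳ (nℚ s))
ratio≡nℚ*ratio1 s (suc n) rewrite nℚ≡mkℚ s | QP.normalize-coprime {1} {n} (Coprime.1-coprimeTo (suc n)) =
  QP./-cong (≡.sym (ℤP.*-identityʳ (ℤ.+ s))) (≡.sym (ℕP.*-identityˡ (suc n)))

nℚ*ratio1≡1 : ∀ n .{{_ : NonZero n}} → nℚ n * ratio 1 n ≡ 1ℚ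
nℚ*ratio1≡1 (suc n) rewrite nℚ≡mkℚ (suc n) | QP.normalize-coprime {1} {n} (Coprime.1-coprimeTo (suc n)) =
  QP.*-inverseʳ (mkℚ (ℤ.+ suc n) 0 (Coprime.sym (Coprime.1-coprimeTo (suc n))))

ratio1-nonNeg : ∀ n → 0ℚ ℚ.≤ ratio 1 n
ratio1-nonNeg zero = QP.≤-refl
ratio1-nonNeg (suc n) rewrite QP.normalize-coprime {1} {n} (Coprime.1-coprimeTo (suc n)) = ℚ.*≤* (ℤ.+≤+ ℕ.z≤n)

<ratio⇒*nℚ< : ∀ {q} s n → 0ℚ ℚ.≤ q → q ℚ.< ratio s n → q * nℚ n ℚ.< nℚ s
<ratio⇒*nℚ< s zero 0≤q q<0 = ⊥-elim (QP.<-irrefl refl (QP.≤-<-trans 0≤q q<0))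
<ratio⇒*nℚ< {q} s n@(suc _) _ q<s/n = begin-strict
  q * nℚ n                   <⟨ QP.*-monoˡ-<-pos (nℚ n) {{QP.normalize-pos n 1}} q<s/n ⟩
  ratio s n * nℚ n           ≡⟨ cong (_* nℚ n) (ratio≡nℚ*ratio1 s n) ⟩
  nℚ s * ratio 1 n * nℚ n    ≡⟨ QP.*-assoc (nℚ s) _ _ ⟩
  nℚ s * (ratio 1 n * nℚ n)  ≡⟨ cong (nℚ s *_) (trans (QP.*-comm (ratio 1 n) (nℚ n)) (nℚ*ratio1≡1 n)) ⟩
  nℚ s * 1ℚ                  ≡⟨ QP.*-identityʳ (nℚ s) ⟩
  nℚ s                       ∎
  where open QP.≤-Reasoning

*<⇒<divℚ : ∀ {q a b} → 0ℚ ℚ.< b → q * b ℚ.< a → q ℚ.< divℚ a b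
*<⇒<divℚ {q} {a} {b} 0<b qb<a with b QP.≟ 0ℚ
... | yes b≡0 = ⊥-elim (QP.<-irrefl (≡.sym b≡0) 0<b)
... | no b≢0 = QP.*-cancelʳ-<-nonNeg b {{ℚ.nonNegative (QP.<⇒≤ 0<b)}} (begin-strict
  q * b            <⟨ qb<a ⟩
  a                ≡⟨ ≡.sym (QP.*-identityʳ a) ⟩
  a * 1ℚ           ≡⟨ cong (a *_) (≡.sym (QP.*-inverseˡ b)) ⟩
  a * (1/ b * b)   ≡⟨ ≡.sym (QP.*-assoc a (1/ b) b) ⟩
  a * 1/ b * b     ∎)
  where
  open QP.≤-Reasoning
  instance _ = ℚ.≢-nonZero b≢0

<⇒0<- : ∀ {x y} → y ℚ.< x → 0ℚ ℚ.< x - y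
<⇒0<- {x} {y} y<x = subst (ℚ._< x - y) (QP.+-inverseʳ y) (QP.+-monoˡ-< (- y) y<x)

0<-⇒< : ∀ {x y} → 0ℚ ℚ.< x - y → y ℚ.< x
0<-⇒< {x} {y} 0<x-y =
  subst₂ ℚ._<_ (QP.+-identityˡ y) (solve 2 (λ x y → (x :- y) :+ y := x) refl x y) (QP.+-monoˡ-< y 0<x-y)

≤⇒-≤0 : ∀ {x y} → x ℚ.≤ y → x - y ℚ.≤ 0ℚ
≤⇒-≤0 {x} {y} x≤y = subst (x - y ℚ.≤_) (QP.+-inverseʳ y) (QP.+-monoˡ-≤ (- y) x≤y)

when : Bool → ℚ → ℚ
when b x = if b then x else 0ℚ

0<when⇒ : ∀ b {x} → 0ℚ ℚ.< when b x → T b × 0ℚ ℚ.< x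
0<when⇒ true  0<x = _ , 0<x
0<when⇒ false 0<0 = ⊥-elim (QP.<-irrefl refl 0<0)

when-not+when : ∀ b x → when (not b) x + when b x ≡ x
when-not+when true  x = QP.+-identityˡ x
when-not+when false x = QP.+-identityʳ x

when-+ : ∀ b x y → when b (x + y) ≡ when b x + when b y
when-+ true  x y = refl
when-+ false x y = ≡.sym (QP.+-identityˡ 0ℚ)

when-sub-scaled : ∀ b q x y → when b (x - q * y) ≡ when b x - q * when b y
when-sub-scaled true  q x y = refl
when-sub-scaled false q x y = solve 1 (λ q → con 0ℚ := con 0ℚ :- q :* con 0ℚ) refl q

when≡*when1 : ∀ b x → when b x ≡ x * when b 1ℚ
when≡*when1 true  x = ≡.sym (QP.*-identityʳ x)
when≡*when1 false x = ≡.sym (QP.*-zeroʳ x)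

when-∑ : ∀ b {n} (f : Fin n → ℚ) → when b (∑[ i < n ] f i) ≡ ∑[ i < n ] when b (f i)
when-∑ true  f = refl
when-∑ false {n} f = ≡.sym (sum-replicate-zero n)

∑-mono-≤ : ∀ {n} {f g : Fin n → ℚ} → (∀ i → f i ℚ.≤ g i) → ∑[ i < n ] f i ℚ.≤ ∑[ i < n ] g i
∑-mono-≤ {zero}  f≤g = QP.≤-refl
∑-mono-≤ {suc n} f≤g = QP.+-mono-≤ (f≤g zero) (∑-mono-≤ (f≤g ∘ suc))

0<∑⇒∃ : ∀ {n} (f : Fin n → ℚ) → 0ℚ ℚ.< ∑[ i < n ] f i → ∃ λ i → 0ℚ ℚ.< f i
0<∑⇒∃ {zero}  f 0<0 = ⊥-elim (QP.<-irrefl refl 0<0)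
0<∑⇒∃ {suc n} f 0<∑ with 0ℚ QP.<? f zero
... | yes 0<f0 = zero , 0<f0
... | no 0≮f0 = let i , 0<fi = 0<∑⇒∃ (f ∘ suc) (QP.≰⇒> ∑tail≰0) in suc i , 0<fi
  where
  ∑tail≰0 : ¬ ∑[ i < n ] f (suc i) ℚ.≤ 0ℚ
  ∑tail≰0 ∑tail≤0 = QP.<-irrefl refl (QP.<-≤-trans 0<∑
    (QP.≤-trans (QP.+-mono-≤ (QP.≮⇒≥ 0≮f0) ∑tail≤0) (QP.≤-reflexive (QP.+-identityˡ 0ℚ))))

∑-sub : ∀ {n} (f g : Fin n → ℚ) → ∑[ i < n ] (f i - g i) ≡ ∑[ i < n ] f i - ∑[ i < n ] g i
∑-sub {zero}  f g = refl
∑-sub {suc n} f g rewrite ∑-sub (f ∘ suc) (g ∘ suc) =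
  solve 4 (λ a b c d → (a :- b) :+ (c :- d) := (a :+ c) :- (b :+ d)) refl
    (f zero) (g zero) (∑[ i < n ] f (suc i)) (∑[ i < n ] g (suc i))

∑-const : ∀ n x → ∑[ i < n ] x ≡ nℚ n * x
∑-const zero    x = ≡.sym (QP.*-zeroˡ x)
∑-const (suc n) x rewrite ∑-const n x | nℚ-+ 1 n =
  solve 2 (λ x m → x :+ m :* x := (con 1ℚ :+ m) :* x) refl x (nℚ n)

sumℚ : List ℚ → ℚ
sumℚ = foldr _+_ 0ℚ

sumℚ-tabulate : ∀ {n} (f : Fin n → ℚ) → sumℚ (tabulate f) ≡ ∑[ i < n ] f i
sumℚ-tabulate {zero}  f = refl
sumℚ-tabulate {suc n} f = cong (f zero +_) (sumℚ-tabulate (f ∘ suc))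

sumℚ-allFin : ∀ {n} (f : Fin n → ℚ) → sumℚ (map f (allFin n)) ≡ ∑[ i < n ] f i
sumℚ-allFin {n} f = trans (cong sumℚ (LP.map-tabulate id f)) (sumℚ-tabulate f)

nℚ-sum : ∀ ns → nℚ (sumℕ ns) ≡ sumℚ (map nℚ ns)
nℚ-sum []       = refl
nℚ-sum (m ∷ ns) = trans (nℚ-+ m (sumℕ ns)) (cong (nℚ m +_) (nℚ-sum ns))

nℚ-sum-allFin : ∀ {n} (f : Fin n → ℕ) → nℚ (sumℕ (map f (allFin n))) ≡ ∑[ i < n ] nℚ (f i)
nℚ-sum-allFin {n} f = begin
  nℚ (sumℕ (map f (allFin n)))      ≡⟨ nℚ-sum (map f (allFin n)) ⟩
  sumℚ (map nℚ (map f (allFin n)))  ≡⟨ cong sumℚ (LP.map-∘ (allFin n)) ⟨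
  sumℚ (map (nℚ ∘ f) (allFin n))    ≡⟨ sumℚ-allFin (nℚ ∘ f) ⟩
  ∑[ i < n ] nℚ (f i)               ∎
  where open ≡.≡-Reasoning

nℚ-length : ∀ {A : Set} (xs : List A) → nℚ (length xs) ≡ sumℚ (map (λ _ → 1ℚ) xs)
nℚ-length []       = refl
nℚ-length (x ∷ xs) = trans (nℚ-+ 1 (length xs)) (cong (1ℚ +_) (nℚ-length xs))

length≡sum-map-1 : ∀ {A : Set} (xs : List A) → length xs ≡ sumℕ (map (λ _ → 1) xs)
length≡sum-map-1 []       = refl
length≡sum-map-1 (x ∷ xs) = cong suc (length≡sum-map-1 xs)

foldr-map-filter : ∀ {A B : Set} {P : Pred A 0ℓ} (P? : Decidable P) {_∙_ : B → B → B} {ε : B} →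
  (∀ y → ε ∙ y ≡ y) → (f : A → B) (xs : List A) →
  foldr _∙_ ε (map f (filter P? xs)) ≡ foldr _∙_ ε (map (λ x → if does (P? x) then f x else ε) xs)
foldr-map-filter P? ε∙y≡y f []       = refl
foldr-map-filter P? {_∙_} ε∙y≡y f (x ∷ xs) with does (P? x)
... | true  = cong (f x ∙_) (foldr-map-filter P? ε∙y≡y f xs)
... | false = trans (foldr-map-filter P? ε∙y≡y f xs) (≡.sym (ε∙y≡y _))

sum-fromList : ∀ ns → Vec.sum (Vec.fromList ns) ≡ sumℕ ns
sum-fromList []       = refl
sum-fromList (m ∷ ns) = cong (m ℕ.+_) (sum-fromList ns)

when-drop : ∀ a b s {x} → (T s → x ℚ.≤ 0ℚ) →
  when s (when b x) ℚ.≤ when (not a) (when b (when s x))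
when-drop true  true  true  x≤0 = x≤0 _
when-drop false true  true  _   = QP.≤-refl
when-drop true  false true  _   = QP.≤-refl
when-drop false false true  _   = QP.≤-refl
when-drop true  _     false _   = QP.≤-refl
when-drop false true  false _   = QP.≤-refl
when-drop false false false _   = QP.≤-refl

discharge : ∀ {n} (adj : Fin n → Fin n → Bool) → (∀ u v → adj u v ≡ adj v u) →
  (small : Fin n → Bool) (c : Fin n → ℚ) → (∀ u → T (small u) → c u ℚ.≤ 0ℚ) →
  ∑[ u < n ] when (small u) (∑[ v < n ] when (adj u v) (c u))
    ℚ.≤ ∑[ v < n ] when (not (small v)) (∑[ u < n ] when (adj v u) (when (small u) (c u)))
discharge {n} adj adj-sym small c c≤0 = begin
  ∑[ u < n ] when (small u) (∑[ v < n ] when (adj u v) (c u))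
    ≡⟨ sum-cong-≗ (λ u → when-∑ (small u) (λ v → when (adj u v) (c u))) ⟩
  ∑[ u < n ] ∑[ v < n ] when (small u) (when (adj u v) (c u))
    ≤⟨ ∑-mono-≤ (λ u → ∑-mono-≤ (λ v → drop-small-neighbour u v)) ⟩
  ∑[ u < n ] ∑[ v < n ] when (not (small v)) (when (adj v u) (when (small u) (c u)))
    ≡⟨ ∑-comm (λ u v → when (not (small v)) (when (adj v u) (when (small u) (c u)))) ⟩
  ∑[ v < n ] ∑[ u < n ] when (not (small v)) (when (adj v u) (when (small u) (c u)))
    ≡⟨ sum-cong-≗ (λ v → when-∑ (not (small v)) (λ u → when (adj v u) (when (small u) (c u)))) ⟨
  ∑[ v < n ] when (not (small v)) (∑[ u < n ] when (adj v u) (when (small u) (c u))) ∎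
  where
  open QP.≤-Reasoning
  drop-small-neighbour : ∀ u v → when (small u) (when (adj u v) (c u))
    ℚ.≤ when (not (small v)) (when (adj v u) (when (small u) (c u)))
  drop-small-neighbour u v rewrite adj-sym v u = when-drop (small v) (adj u v) (small u) (c≤0 u)

0<b-K : ∀ K {d} (x : Vec ℕ d) → 0ℚ ℚ.< b-K K x
0<b-K K x = QP.<-≤-trans (ℚ.*<* (ℤ.+<+ ℕ.z<s)) (QP.+-monoʳ-≤ 1ℚ (0≤sumℚ-ratio1 (small K (Vec.toList x))))
  where
  0≤sumℚ-ratio1 : ∀ ns → 0ℚ ℚ.≤ sumℚ (map (ratio 1) ns)
  0≤sumℚ-ratio1 []       = QP.≤-refl
  0≤sumℚ-ratio1 (m ∷ ns) = QP.+-mono-≤ (ratio1-nonNeg m) (0≤sumℚ-ratio1 ns)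

neighbourDegrees : (G : Graph) → Fin (n G) → List ℕ
neighbourDegrees G v = map (deg G) (filter (T? ∘ adj G v) (allFin (n G)))

module Neighbourhood (G : Graph) (K : ℕ) where

  N : ℕ
  N = n G

  isSmall : Fin N → Bool
  isSmall u = does (deg G u ℕ.<? K)

  large⇒K≤deg : ∀ v → T (not (isSmall v)) → K ≤ deg G v
  large⇒K≤deg v large = ℕP.≮⇒≥ (λ deg<K → subst (T ∘ not) (dec-true (deg G v ℕ.<? K) deg<K) large)

  d r : Fin N → ℚ
  d u = nℚ (deg G u)
  r u = ratio 1 (deg G u)

  neighbourTuple : (v : Fin N) → Vec ℕ (length (neighbourDegrees G v))
  neighbourTuple v = Vec.fromList (neighbourDegrees G v)

  <avgDeg⇒*<∑d : ∀ {q} → 0ℚ ℚ.≤ q → q ℚ.< avgDeg G → nℚ N * q ℚ.< ∑[ v < N ] d v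
  <avgDeg⇒*<∑d {q} 0≤q q<avg = subst₂ ℚ._<_ (QP.*-comm q (nℚ N)) (nℚ-sum-allFin (deg G))
    (<ratio⇒*nℚ< (sumℕ (map (deg G) (allFin N))) N 0≤q q<avg)

  length-neighbourDegrees : ∀ v → length (neighbourDegrees G v) ≡ deg G v
  length-neighbourDegrees v = begin
    length (map (deg G) neighbours)  ≡⟨ LP.length-map (deg G) neighbours ⟩
    length neighbours                ≡⟨ length≡sum-map-1 neighbours ⟩
    sumℕ (map (λ _ → 1) neighbours)  ≡⟨ foldr-map-filter (T? ∘ adj G v) ℕP.+-identityˡ (λ _ → 1) (allFin N) ⟩
    deg G v                          ∎
    where
    open ≡.≡-Reasoning
    neighbours = filter (T? ∘ adj G v) (allFin N)

  sum-neighbourTuple : ∀ v → Vec.sum (neighbourTuple v) ≡ twoDeg G v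
  sum-neighbourTuple v = trans (sum-fromList (neighbourDegrees G v))
    (foldr-map-filter (T? ∘ adj G v) ℕP.+-identityˡ (deg G) (allFin N))

  d≡∑ : ∀ v → d v ≡ ∑[ u < N ] when (adj G v u) 1ℚ
  d≡∑ v = trans (nℚ-sum-allFin (λ u → if adj G v u then 1 else 0)) (sum-cong-≗ (nℚ-indicator ∘ adj G v))
    where
    nℚ-indicator : ∀ b → nℚ (if b then 1 else 0) ≡ when b 1ℚ
    nℚ-indicator true  = refl
    nℚ-indicator false = refl

  sumℚ-small-neighbours : ∀ v (g : ℕ → ℚ) →
    sumℚ (map g (small K (neighbourDegrees G v))) ≡ ∑[ u < N ] when (adj G v u) (when (isSmall u) (g (deg G u)))
  sumℚ-small-neighbours v g = begin
    sumℚ (map g (filter (λ m → m ℕ.<? K) (map (deg G) neighbours)))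
      ≡⟨ foldr-map-filter (λ m → m ℕ.<? K) QP.+-identityˡ g (map (deg G) neighbours) ⟩
    sumℚ (map (λ m → when (does (m ℕ.<? K)) (g m)) (map (deg G) neighbours))
      ≡⟨ cong sumℚ (LP.map-∘ neighbours) ⟨
    sumℚ (map (λ u → when (isSmall u) (g (deg G u))) neighbours)
      ≡⟨ foldr-map-filter (T? ∘ adj G v) QP.+-identityˡ (λ u → when (isSmall u) (g (deg G u))) (allFin N) ⟩
    sumℚ (map (λ u → when (adj G v u) (when (isSmall u) (g (deg G u)))) (allFin N))
      ≡⟨ sumℚ-allFin (λ u → when (adj G v u) (when (isSmall u) (g (deg G u)))) ⟩
    ∑[ u < N ] when (adj G v u) (when (isSmall u) (g (deg G u))) ∎
    where
    open ≡.≡-Reasoning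
    neighbours = filter (T? ∘ adj G v) (allFin N)

  a-K-neighbourTuple : ∀ v → nℚ (a-K K (neighbourTuple v)) ≡ d v + ∑[ u < N ] when (adj G v u) (when (isSmall u) 1ℚ)
  a-K-neighbourTuple v = begin
    nℚ (length l ℕ.+ length (small K (Vec.toList (Vec.fromList l))))
      ≡⟨ cong (λ ns → nℚ (length l ℕ.+ length (small K ns))) (VP.toList∘fromList l) ⟩
    nℚ (length l ℕ.+ length (small K l))
      ≡⟨ nℚ-+ (length l) (length (small K l)) ⟩
    nℚ (length l) + nℚ (length (small K l))
      ≡⟨ cong₂ _+_ (cong nℚ (length-neighbourDegrees v))
                   (trans (nℚ-length (small K l)) (sumℚ-small-neighbours v (λ _ → 1ℚ))) ⟩
    d v + ∑[ u < N ] when (adj G v u) (when (isSmall u) 1ℚ) ∎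
    where
    open ≡.≡-Reasoning
    l = neighbourDegrees G v

  b-K-neighbourTuple : ∀ v → b-K K (neighbourTuple v) ≡ 1ℚ + ∑[ u < N ] when (adj G v u) (when (isSmall u) (r u))
  b-K-neighbourTuple v = begin
    1ℚ + sumℚ (map (ratio 1) (small K (Vec.toList (Vec.fromList l))))
      ≡⟨ cong (λ ns → 1ℚ + sumℚ (map (ratio 1) (small K ns))) (VP.toList∘fromList l) ⟩
    1ℚ + sumℚ (map (ratio 1) (small K l))
      ≡⟨ cong (1ℚ +_) (sumℚ-small-neighbours v (ratio 1)) ⟩
    1ℚ + ∑[ u < N ] when (adj G v u) (when (isSmall u) (r u)) ∎
    where
    open ≡.≡-Reasoning
    l = neighbourDegrees G v

  neighbourTuple-achievable : ∀ k {q} v → Above k q → (∀ u → 2 ≤ deg G u) → K ≤ deg G v →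
    q ℚ.< aad* K (neighbourTuple v) → Achievable k K (twoDeg G v)
  neighbourTuple-achievable k v k<q δ≥2 K≤deg q<aad* =
    length (neighbourDegrees G v) , subst (K ≤_) (≡.sym (length-neighbourDegrees v)) K≤deg ,
    neighbourTuple v , AllV.fromList⁺ (AllLP.map⁺ (AllL.universal δ≥2 _)) , sum-neighbourTuple v ,
    upward k k<q (QP.<⇒≤ q<aad*)

  module Charges (q : ℚ) where

    c : Fin N → ℚ
    c u = 1ℚ - q * r u

    gain excess : Fin N → ℚ
    gain v = ∑[ u < N ] when (adj G v u) (when (isSmall u) (c u))
    excess v = nℚ (a-K K (neighbourTuple v)) - q * b-K K (neighbourTuple v)

    excess≡charge+gain : ∀ v → excess v ≡ (d v - q) + gain v
    excess≡charge+gain v = begin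
      excess v
        ≡⟨ cong₂ (λ a b → a - q * b) (a-K-neighbourTuple v) (b-K-neighbourTuple v) ⟩
      (d v + sum E₁) - q * (1ℚ + sum E₂)
        ≡⟨ solve 4 (λ d q s₁ s₂ → (d :+ s₁) :- q :* (con 1ℚ :+ s₂) := (d :- q) :+ (s₁ :- q :* s₂)) refl
             (d v) q (sum E₁) (sum E₂) ⟩
      (d v - q) + (sum E₁ - q * sum E₂)
        ≡⟨ cong (λ s → (d v - q) + (sum E₁ - s)) (*-distribˡ-sum q E₂) ⟩
      (d v - q) + (sum E₁ - ∑[ u < N ] (q * E₂ u))
        ≡⟨ cong ((d v - q) +_) (∑-sub E₁ (λ u → q * E₂ u)) ⟨
      (d v - q) + ∑[ u < N ] (E₁ u - q * E₂ u)
        ≡⟨ cong ((d v - q) +_) (sum-cong-≗ pointwise) ⟨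
      (d v - q) + gain v ∎
      where
      open ≡.≡-Reasoning
      E₁ E₂ : Fin N → ℚ
      E₁ u = when (adj G v u) (when (isSmall u) 1ℚ)
      E₂ u = when (adj G v u) (when (isSmall u) (r u))
      pointwise : ∀ u → when (adj G v u) (when (isSmall u) (c u)) ≡ E₁ u - q * E₂ u
      pointwise u = trans (cong (when (adj G v u)) (when-sub-scaled (isSmall u) q 1ℚ (r u)))
                          (when-sub-scaled (adj G v u) q _ _)

    charge-spread : ∀ u → 1 ≤ deg G u → d u - q ≡ ∑[ v < N ] when (adj G u v) (c u)
    charge-spread u 1≤deg = ≡.sym (begin
      ∑[ v < N ] when (adj G u v) (c u)         ≡⟨ sum-cong-≗ (λ v → when≡*when1 (adj G u v) (c u)) ⟩
      ∑[ v < N ] (c u * when (adj G u v) 1ℚ)     ≡⟨ *-distribˡ-sum (c u) (λ v → when (adj G u v) 1ℚ) ⟨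
      c u * ∑[ v < N ] when (adj G u v) 1ℚ      ≡⟨ cong (c u *_) (d≡∑ u) ⟨
      (1ℚ - q * r u) * d u                      ≡⟨ solve 3 (λ q r d → (con 1ℚ :- q :* r) :* d := d :- q :* (d :* r)) refl q (r u) (d u) ⟩
      d u - q * (d u * r u)                     ≡⟨ cong (λ t → d u - q * t) (nℚ*ratio1≡1 (deg G u) {{ℕ.>-nonZero 1≤deg}}) ⟩
      d u - q * 1ℚ                              ≡⟨ cong (λ t → d u - t) (QP.*-identityʳ q) ⟩
      d u - q                                   ∎)
      where open ≡.≡-Reasoning

    module _ (δ≥1 : ∀ u → 1 ≤ deg G u) (small⇒≤q : ∀ u → deg G u ℕ.< K → d u ℚ.≤ q) where

      c≤0 : ∀ u → T (isSmall u) → c u ℚ.≤ 0ℚ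
      c≤0 u small = ≤⇒-≤0 (begin
        1ℚ          ≡⟨ nℚ*ratio1≡1 (deg G u) {{ℕ.>-nonZero (δ≥1 u)}} ⟨
        d u * r u   ≤⟨ QP.*-monoʳ-≤-nonNeg (r u) {{ℚ.nonNegative (ratio1-nonNeg (deg G u))}}
                         (small⇒≤q u (ℕP.<ᵇ⇒< (deg G u) K small)) ⟩
        q * r u     ∎)
        where open QP.≤-Reasoning

      ∑charge≤∑excess : ∑[ v < N ] (d v - q) ℚ.≤ ∑[ v < N ] when (not (isSmall v)) (excess v)
      ∑charge≤∑excess = begin
        ∑[ v < N ] (d v - q)
          ≡⟨ sum-cong-≗ (λ v → when-not+when (isSmall v) (d v - q)) ⟨
        ∑[ v < N ] (when (not (isSmall v)) (d v - q) + when (isSmall v) (d v - q))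
          ≡⟨ ∑-distrib-+ (λ v → when (not (isSmall v)) (d v - q)) (λ v → when (isSmall v) (d v - q)) ⟩
        ∑[ v < N ] when (not (isSmall v)) (d v - q) + ∑[ u < N ] when (isSmall u) (d u - q)
          ≡⟨ cong (∑[ v < N ] when (not (isSmall v)) (d v - q) +_)
                  (sum-cong-≗ (λ u → cong (when (isSmall u)) (charge-spread u (δ≥1 u)))) ⟩
        ∑[ v < N ] when (not (isSmall v)) (d v - q) + ∑[ u < N ] when (isSmall u) (∑[ v < N ] when (adj G u v) (c u))
          ≤⟨ QP.+-monoʳ-≤ (∑[ v < N ] when (not (isSmall v)) (d v - q)) (discharge (adj G) (Graph.sym G) isSmall c c≤0) ⟩
        ∑[ v < N ] when (not (isSmall v)) (d v - q) + ∑[ v < N ] when (not (isSmall v)) (gain v)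
          ≡⟨ ∑-distrib-+ (λ v → when (not (isSmall v)) (d v - q)) (λ v → when (not (isSmall v)) (gain v)) ⟨
        ∑[ v < N ] (when (not (isSmall v)) (d v - q) + when (not (isSmall v)) (gain v))
          ≡⟨ sum-cong-≗ (λ v → trans (cong (when (not (isSmall v))) (excess≡charge+gain v))
                                      (when-+ (not (isSmall v)) (d v - q) (gain v))) ⟨
        ∑[ v < N ] when (not (isSmall v)) (excess v) ∎
        where open QP.≤-Reasoning

      large-vertex-with-positive-excess : nℚ N * q ℚ.< ∑[ v < N ] d v →
        ∃ λ v → K ≤ deg G v × q * b-K K (neighbourTuple v) ℚ.< nℚ (a-K K (neighbourTuple v))
      large-vertex-with-positive-excess qN<∑d =
        let v , 0<excess = 0<∑⇒∃ (λ v → when (not (isSmall v)) (excess v)) (QP.<-≤-trans 0<∑charge ∑charge≤∑excess)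
            large , 0<excess′ = 0<when⇒ (not (isSmall v)) 0<excess
        in v , large⇒K≤deg v large , 0<-⇒< 0<excess′
        where
        0<∑charge : 0ℚ ℚ.< ∑[ v < N ] (d v - q)
        0<∑charge = subst (0ℚ ℚ.<_) (≡.sym (trans (∑-sub d (λ _ → q)) (cong (λ t → sum d - t) (∑-const N q))))
                          (<⇒0<- qN<∑d)

      large-two-degree-vertex : ∀ k {z} → Above k q → (∀ z′ → Achievable k K z′ → z ≤ z′) →
        (∀ u → 2 ≤ deg G u) → nℚ N * q ℚ.< ∑[ v < N ] d v →
        ∃ λ v → K ≤ deg G v × z ≤ twoDeg G v
      large-two-degree-vertex k k<q D₂-minimal δ≥2 qN<∑d =
        let v , K≤deg , qb<a = large-vertex-with-positive-excess qN<∑d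
        in v , K≤deg , D₂-minimal (twoDeg G v)
             (neighbourTuple-achievable k v k<q δ≥2 K≤deg (*<⇒<divℚ (0<b-K K (neighbourTuple v)) qb<a))

lemma8 : (k : Real) (K : ℕ) → AtLeast2 k → IsFloorSuc k K →
    (z : ℕ) → IsD2 k K z →
    (G : Graph) → (∀ v → 2 ≤ deg G v) →
    Above k (avgDeg G) → avgDeg G ℚ.≤ nℚ K →
    ∃ λ v → (K ≤ deg G v) × (z ≤ twoDeg G v)
lemma8 k K _ (m , refl , k≮m , _) z (_ , D₂-minimal) G δ≥2 k<avg _ = below-avg (open-cut k k<avg)
  where
  below-avg : (∃ λ q → q ℚ.< avgDeg G × Above k q) → ∃ λ v → (K ≤ deg G v) × (z ≤ twoDeg G v)
  below-avg (q , q<avg , k<q) =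
    Neighbourhood.Charges.large-two-degree-vertex G K q δ≥1 small⇒≤q k k<q D₂-minimal δ≥2
      (Neighbourhood.<avgDeg⇒*<∑d G K (QP.<⇒≤ (QP.≤-<-trans (nℚ-mono-≤ {0} {m} ℕ.z≤n) m<q)) q<avg)
    where
    m<q : nℚ m ℚ.< q
    m<q = QP.≰⇒> (λ q≤m → k≮m (upward k k<q q≤m))
    δ≥1 : ∀ u → 1 ≤ deg G u
    δ≥1 u = ℕP.≤-trans (ℕ.s≤s ℕ.z≤n) (δ≥2 u)
    small⇒≤q : ∀ u → deg G u ℕ.< K → nℚ (deg G u) ℚ.≤ q
    small⇒≤q u deg<K = QP.<⇒≤ (QP.≤-<-trans (nℚ-mono-≤ {deg G u} {m} (ℕ.s≤s⁻¹ deg<K)) m<q)
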